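{- For any positive integer $k$ and any $w\in A^{\ast}$, we have $$y\overset{t}{\sqcup\!\sqcup} z_kw=\begin{cases} \sum\limits_{i=1}^kz_iz_{k+1-i}-(k+1)tz_{k+1}+z_kz_1 & \text{if\;} w=1,\\ \sum\limits_{i=1}^kz_iz_{k+1-i}w-ktz_{k+1}w+z_k(y\overset{t}{\sqcup\!\sqcup} w) & \text{if\;} w\neq 1. \end{cases}$$
   Context: Let $A=\{x,y\}$ be an alphabet of two noncommutative letters, $A^{\ast}$ the set of words (including the empty word $1$), $\mathfrak{h}_t=\mathbb{Q}[t]\langle A\rangle$, and $z_k=x^{k-1}y$ (so $z_1=y$). The $t$-shuffle product $\overset{t}{\sqcup\!\sqcup}$ is the $\mathbb{Q}[t]$-bilinear product on $\mathfrak{h}_t$ with $1\overset{t}{\sqcup\!\sqcup} w=w\overset{t}{\sqcup\!\sqcup} 1=w$ and $aw_1\overset{t}{\sqcup\!\sqcup} bw_2=a(w_1\overset{t}{\sqcup\!\sqcup} bw_2)+b(aw_1\overset{t}{\sqcup\!\sqcup} w_2)-\delta(w_1)\rho(a)bw_2-\delta(w_2)\rho(b)aw_1$ for $w,w_1,w_2\in A^\ast$, $a,b\in A$, where $\delta(w)=1$ if $w=1$ and $0$ otherwise, and $\rho(x)=0$, $\rho(y)=tx$. -}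

module Defs where

open import Data.Nat using (ℕ; zero; suc; _+_; _∸_)
open import Data.Rational using (ℚ; 0ℚ; 1ℚ; -_; _*_; _/_) renaming (_+_ to _+ℚ_)
open import Data.List using (List; []; _∷_; _++_; map; concatMap; replicate; upTo; foldr)
open import Data.Product using (_×_; _,_)
open import Relation.Binary.PropositionalEquality using (_≡_)
open import Data.Bool using (if_then_else_)
open import Data.Nat using (_≡ᵇ_)

data Letter : Set where
  x y : Letter

-- A* : words (the empty word 1 is [])
Word : Set
Word = List Letter

letter-eqᵇ : Letter → Letter → Data.Bool.Bool
letter-eqᵇ x x = Data.Bool.true
letter-eqᵇ y y = Data.Bool.true
letter-eqᵇ _ _ = Data.Bool.false

word-eqᵇ : Word → Word → Data.Bool.Bool
word-eqᵇ [] [] = Data.Bool.true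
word-eqᵇ (a ∷ u) (b ∷ v) = letter-eqᵇ a b Data.Bool.∧ word-eqᵇ u v
word-eqᵇ _ _ = Data.Bool.false

-- Elements of h_t = ℚ[t]⟨A⟩ represented as finite formal sums of
-- monomials  c · t^n · w  with c ∈ ℚ, n ∈ ℕ, w ∈ A*.
Term : Set
Term = ℚ × ℕ × Word

Poly : Set
Poly = List Term

coeff : Poly → ℕ → Word → ℚ
coeff [] n w = 0ℚ
coeff ((c , m , u) ∷ p) n w =
  (if (m ≡ᵇ n) Data.Bool.∧ word-eqᵇ u w then c else 0ℚ) +ℚ coeff p n w

infix 4 _≈_
_≈_ : Poly → Poly → Set
p ≈ q = ∀ (n : ℕ) (w : Word) → coeff p n w ≡ coeff q n w

mono : Word → Poly
mono w = (1ℚ , 0 , w) ∷ []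

infixl 6 _⊕_
_⊕_ : Poly → Poly → Poly
p ⊕ q = p ++ q

scale : ℚ → ℕ → Poly → Poly
scale c n = map (λ { (d , m , u) → (c * d , n + m , u) })

prefix : Word → Poly → Poly
prefix v = map (λ { (d , m , u) → (d , m , v ++ u) })

ρ : Letter → Poly
ρ x = []
ρ y = (1ℚ , 1 , x ∷ []) ∷ []

-- - δ(w₁) ρ(a) b w₂
δρ : Word → Letter → Word → Poly
δρ [] a bw = scale (- 1ℚ) 0 (map (λ { (d , m , u) → (d , m , u ++ bw) }) (ρ a))
δρ (_ ∷ _) a bw = []

shw : Word → Word → Poly
shw [] v = mono v
shw (a ∷ u) [] = mono (a ∷ u)
shw (a ∷ u) (b ∷ v) =
  prefix (a ∷ []) (shw u (b ∷ v)) ⊕ prefix (b ∷ []) (shw (a ∷ u) v)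
  ⊕ δρ u a (b ∷ v) ⊕ δρ v b (a ∷ u)

infixl 7 _⧢_
_⧢_ : Poly → Poly → Poly
p ⧢ q = concatMap (λ { (c , m , u) → concatMap (λ { (d , n , v) → scale (c * d) (m + n) (shw u v) }) q }) p

z : ℕ → Word
z k = replicate (k ∸ 1) x ++ (y ∷ [])

ℕ→ℚ : ℕ → ℚ
ℕ→ℚ n = Data.Rational.fromℚᵘ (Data.Rational.Unnormalised.mkℚᵘ (Data.Integer.+ n) 0)
  where import Data.Rational.Unnormalised ; import Data.Integer

sumZ : ℕ → Word → Poly
sumZ k w = map (λ j → (1ℚ , 0 , z (suc j) ++ z (k + 1 ∸ suc j) ++ w)) (upTo k)

cmono : ℚ → ℕ → Word → Poly
cmono c n w = (c , n , w) ∷ []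

{-# OPTIONS --safe #-}
module Submission where

-- For k ≥ 2 one unfolding of the t-shuffle gives
--   y ⧢ z_k w = z_1 z_k w + x (y ⧢ z_{k−1} w) − t z_{k+1} w,
-- the second boundary term being killed by ρ(x) = 0, and x z_i z_{k−i} w = z_{i+1} z_{k−i} w.
-- Starting from y ⧢ y w = y y w + y (y ⧢ w) − t x y w − δ(w) t x y, induction on k gives
--   y ⧢ z_k w = Σ_{i=1}^k z_i z_{k+1−i} w − k t z_{k+1} w + z_k (y ⧢ w) − δ(w) t x^{k−1} x y.
-- For w ≠ 1 the last term vanishes; for w = 1 it is −t z_{k+1}, and z_k (y ⧢ 1) = z_k z_1.

open import Defs
open import Data.Nat using (ℕ; suc; _≤_; _+_)
open import Data.Rational using (1ℚ; -_)
open import Data.List using (List; []; _∷_; _++_)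
open import Data.Product using (_×_; _,_)
open import Relation.Binary.PropositionalEquality using (_≡_; _≢_)

open import Level using (0ℓ)
open import Data.Bool using (true; false; _∧_; if_then_else_)
open import Data.Bool.Properties using (∧-zeroʳ)
open import Data.Nat using (_≡ᵇ_)
open import Data.Nat.Properties using (+-comm)
import Data.Integer as ℤ
import Data.Integer.Properties as ℤ
open import Data.Rational using (0ℚ; fromℚᵘ) renaming (_+_ to _+ℚ_)
import Data.Rational.Properties as ℚ
import Data.Rational.Unnormalised as ℚᵘ
import Data.Rational.Unnormalised.Properties as ℚᵘ
open import Data.List using (replicate; upTo)
open import Data.List.Properties using (map-++; map-∘; map-id; map-cong; map-applyUpTo; ++-assoc; ++-identityʳ)
open import Data.Fin using (zero; suc)
open import Data.Vec using ([]; _∷_)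
open import Data.Empty using (⊥-elim)
open import Data.Wrap using (Wrap; [_]; get)
open import Algebra.Bundles using (CommutativeMonoid)
open import Relation.Binary.PropositionalEquality using (refl; sym; trans; cong; cong₂)

-- Wrapping _≈_ (a function type) in a record makes it injective, so that
-- Agda can infer the polynomials related by a proof.
infix 4 _≋_
_≋_ : Poly → Poly → Set
_≋_ = Wrap _≈_

≡⇒≋ : ∀ {p q} → p ≡ q → p ≋ q
≡⇒≋ refl = [ (λ n w → refl) ]

coeff-⊕ : ∀ p q n w → coeff (p ⊕ q) n w ≡ coeff p n w +ℚ coeff q n w
coeff-⊕ [] q n w = sym (ℚ.+-identityˡ (coeff q n w))
coeff-⊕ ((c , m , u) ∷ p) q n w =
  trans (cong (head +ℚ_) (coeff-⊕ p q n w)) (sym (ℚ.+-assoc head (coeff p n w) (coeff q n w)))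
  where head = if (m ≡ᵇ n) ∧ word-eqᵇ u w then c else 0ℚ

⊕-commutativeMonoid : CommutativeMonoid 0ℓ 0ℓ
⊕-commutativeMonoid = record
  { Carrier = Poly
  ; _≈_ = _≋_
  ; _∙_ = _⊕_
  ; ε = []
  ; isCommutativeMonoid = record
    { isMonoid = record
      { isSemigroup = record
        { isMagma = record
          { isEquivalence = record
            { refl  = [ (λ n w → refl) ]
            ; sym   = λ e → [ (λ n w → sym (get e n w)) ]
            ; trans = λ e f → [ (λ n w → trans (get e n w) (get f n w)) ]
            }
          ; ∙-cong = λ {p} {p′} {q} {q′} e f → [ (λ n w →
              trans (coeff-⊕ p q n w) (trans (cong₂ _+ℚ_ (get e n w) (get f n w)) (sym (coeff-⊕ p′ q′ n w)))) ]
          }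
        ; assoc = λ p q r → ≡⇒≋ (++-assoc p q r)
        }
      ; identity = (λ p → ≡⇒≋ refl) , (λ p → ≡⇒≋ (++-identityʳ p))
      }
    ; comm = λ p q → [ (λ n w →
        trans (coeff-⊕ p q n w) (trans (ℚ.+-comm (coeff p n w) (coeff q n w)) (sym (coeff-⊕ q p n w)))) ]
    }
  }

open CommutativeMonoid ⊕-commutativeMonoid using (setoid; ∙-congˡ; ∙-congʳ; identityʳ) renaming (sym to ≋-sym)
open import Relation.Binary.Reasoning.Setoid setoid
open import Algebra.Properties.CommutativeSemigroup (CommutativeMonoid.commutativeSemigroup ⊕-commutativeMonoid)
  using (xy∙z≈xz∙y)
import Algebra.Solver.CommutativeMonoid ⊕-commutativeMonoid as ⊕-Solver

cmono-+ : ∀ a b m u → cmono a m u ⊕ cmono b m u ≋ cmono (a +ℚ b) m u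
cmono-+ a b m u = [ coeffwise ]
  where
  coeffwise : cmono a m u ⊕ cmono b m u ≈ cmono (a +ℚ b) m u
  coeffwise n w with (m ≡ᵇ n) ∧ word-eqᵇ u w
  ... | true  = sym (ℚ.+-assoc a b 0ℚ)
  ... | false = refl

prefix-⊕ : ∀ v p q → prefix v (p ⊕ q) ≡ prefix v p ⊕ prefix v q
prefix-⊕ v = map-++ _

prefix-[] : ∀ p → prefix [] p ≡ p
prefix-[] = map-id

prefix-prefix : ∀ u v p → prefix u (prefix v p) ≡ prefix (u ++ v) p
prefix-prefix u v p =
  trans (sym (map-∘ p)) (map-cong (λ { (d , m , s) → cong (λ s′ → d , m , s′) (sym (++-assoc u v s)) }) p)

coeff-prefix-∷-[] : ∀ a v p n → coeff (prefix (a ∷ v) p) n [] ≡ 0ℚ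
coeff-prefix-∷-[] a v [] n = refl
coeff-prefix-∷-[] a v ((d , m , u) ∷ p) n
  rewrite coeff-prefix-∷-[] a v p n | ∧-zeroʳ (m ≡ᵇ n) = refl

coeff-prefix-∷-∷ : ∀ a v p n b w →
  coeff (prefix (a ∷ v) p) n (b ∷ w) ≡ (if letter-eqᵇ a b then coeff (prefix v p) n w else 0ℚ)
coeff-prefix-∷-∷ a v [] n b w with letter-eqᵇ a b
... | true  = refl
... | false = refl
coeff-prefix-∷-∷ a v ((d , m , u) ∷ p) n b w with letter-eqᵇ a b | coeff-prefix-∷-∷ a v p n b w
... | true  | ih = cong ((if (m ≡ᵇ n) ∧ word-eqᵇ (v ++ u) w then d else 0ℚ) +ℚ_) ih
... | false | ih rewrite ∧-zeroʳ (m ≡ᵇ n) = trans (ℚ.+-identityˡ _) ih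

prefix-cong : ∀ v {p q} → p ≋ q → prefix v p ≋ prefix v q
prefix-cong v {p} {q} e = [ coeffwise v ]
  where
  coeffwise : ∀ v → prefix v p ≈ prefix v q
  coeffwise [] n w = trans (cong (λ r → coeff r n w) (prefix-[] p))
                      (trans (get e n w) (cong (λ r → coeff r n w) (sym (prefix-[] q))))
  coeffwise (a ∷ v) n [] = trans (coeff-prefix-∷-[] a v p n) (sym (coeff-prefix-∷-[] a v q n))
  coeffwise (a ∷ v) n (b ∷ w) = trans (coeff-prefix-∷-∷ a v p n b w)
    (trans (cong (if letter-eqᵇ a b then_else 0ℚ) (coeffwise v n w)) (sym (coeff-prefix-∷-∷ a v q n b w)))

scale-identity : ∀ p → scale 1ℚ 0 p ≡ p
scale-identity [] = refl
scale-identity ((d , m , u) ∷ p) =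
  cong₂ _∷_ (cong (λ d′ → d′ , m , u) (ℚ.*-identityˡ d)) (scale-identity p)

mono-⧢-mono : ∀ u v → mono u ⧢ mono v ≋ shw u v
mono-⧢-mono u v = ≡⇒≋ (trans (++-identityʳ _) (trans (++-identityʳ _) (scale-identity (shw u v))))

fromℚᵘ-homo-+ : ∀ p q → fromℚᵘ (p ℚᵘ.+ q) ≡ fromℚᵘ p +ℚ fromℚᵘ q
fromℚᵘ-homo-+ p q = ℚ.toℚᵘ-injective (ℚᵘ.≃-trans (ℚ.toℚᵘ-fromℚᵘ (p ℚᵘ.+ q)) (ℚᵘ.≃-sym
  (ℚᵘ.≃-trans (ℚ.toℚᵘ-homo-+ (fromℚᵘ p) (fromℚᵘ q)) (ℚᵘ.+-cong (ℚ.toℚᵘ-fromℚᵘ p) (ℚ.toℚᵘ-fromℚᵘ q)))))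

ℕ→ℚ-suc : ∀ n → ℕ→ℚ (suc n) ≡ 1ℚ +ℚ ℕ→ℚ n
ℕ→ℚ-suc n = trans (ℚ.fromℚᵘ-cong {ℚᵘ.mkℚᵘ (ℤ.+ suc n) 0} {ℚᵘ.1ℚᵘ ℚᵘ.+ ℚᵘ.mkℚᵘ (ℤ.+ n) 0} (ℚᵘ.*≡* cross))
                  (fromℚᵘ-homo-+ ℚᵘ.1ℚᵘ (ℚᵘ.mkℚᵘ (ℤ.+ n) 0))
  where
  cross : ℤ.+ suc n ℤ.* ℤ.1ℤ ≡ (ℤ.1ℤ ℤ.* ℤ.1ℤ ℤ.+ ℤ.+ n ℤ.* ℤ.1ℤ) ℤ.* ℤ.1ℤ
  cross = trans (ℤ.*-identityʳ (ℤ.+ suc n))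
    (sym (trans (ℤ.*-identityʳ _) (cong (λ i → ℤ.1ℤ ℤ.+ i) (ℤ.*-identityʳ (ℤ.+ n)))))

-ℕ→ℚ-suc : ∀ n → - ℕ→ℚ (suc n) ≡ - 1ℚ +ℚ - ℕ→ℚ n
-ℕ→ℚ-suc n = trans (cong -_ (ℕ→ℚ-suc n)) (ℚ.neg-distrib-+ 1ℚ (ℕ→ℚ n))

replicate-x-++-z₂ : ∀ j → replicate j x ++ z 2 ≡ x ∷ z (suc j)
replicate-x-++-z₂ 0       = refl
replicate-x-++-z₂ (suc j) = cong (x ∷_) (replicate-x-++-z₂ j)

sumZ-suc : ∀ j w → sumZ (suc (suc j)) w ≡ mono (y ∷ z (suc (suc j)) ++ w) ⊕ prefix (x ∷ []) (sumZ (suc j) w)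
sumZ-suc j w = cong₂ _∷_ (cong (λ k → 1ℚ , 0 , y ∷ z k ++ w) (+-comm (suc j) 1))
  (trans (map-applyUpTo suc _ (suc j))
         (sym (trans (sym (map-∘ (upTo (suc j)))) (map-applyUpTo (λ i → i) _ (suc j)))))

shwʸ : Word → Poly
shwʸ = shw (y ∷ [])

shwʸ-∷ : ∀ b v → shwʸ (b ∷ v)
  ≡ mono (y ∷ b ∷ v) ⊕ prefix (b ∷ []) (shwʸ v) ⊕ cmono (- 1ℚ) 1 (x ∷ b ∷ v) ⊕ δρ v b (y ∷ [])
shwʸ-∷ b v = refl

δρ-x : ∀ u v → δρ u x v ≡ []
δρ-x []      v = refl
δρ-x (_ ∷ _) v = refl

shwʸ-z-++ : ∀ j w → shwʸ (z (suc j) ++ w)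
  ≋ sumZ (suc j) w ⊕ cmono (- ℕ→ℚ (suc j)) 1 (x ∷ z (suc j) ++ w)
    ⊕ prefix (z (suc j)) (shwʸ w) ⊕ prefix (replicate j x) (δρ w y (y ∷ []))
shwʸ-z-++ 0 w = begin
  shwʸ (y ∷ w)
    ≡⟨ shwʸ-∷ y w ⟩
  mono (y ∷ y ∷ w) ⊕ prefix (y ∷ []) (shwʸ w) ⊕ cmono (- 1ℚ) 1 (x ∷ y ∷ w) ⊕ δρ w y (y ∷ [])
    ≈⟨ ∙-congʳ {δρ w y (y ∷ [])} (xy∙z≈xz∙y (mono (y ∷ y ∷ w)) (prefix (y ∷ []) (shwʸ w)) (cmono (- 1ℚ) 1 (x ∷ y ∷ w))) ⟩
  mono (y ∷ y ∷ w) ⊕ cmono (- 1ℚ) 1 (x ∷ y ∷ w) ⊕ prefix (y ∷ []) (shwʸ w) ⊕ δρ w y (y ∷ [])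
    ≡⟨ cong (mono (y ∷ y ∷ w) ⊕ cmono (- 1ℚ) 1 (x ∷ y ∷ w) ⊕ prefix (y ∷ []) (shwʸ w) ⊕_) (sym (prefix-[] _)) ⟩
  mono (y ∷ y ∷ w) ⊕ cmono (- 1ℚ) 1 (x ∷ y ∷ w) ⊕ prefix (y ∷ []) (shwʸ w) ⊕ prefix [] (δρ w y (y ∷ [])) ∎
shwʸ-z-++ (suc j) w = begin
  shwʸ (x ∷ u)
    ≡⟨ shwʸ-∷ x u ⟩
  M ⊕ prefix (x ∷ []) (shwʸ u) ⊕ C₁ ⊕ δρ u x (y ∷ [])
    ≡⟨ cong (M ⊕ prefix (x ∷ []) (shwʸ u) ⊕ C₁ ⊕_) (δρ-x u (y ∷ [])) ⟩
  M ⊕ prefix (x ∷ []) (shwʸ u) ⊕ C₁ ⊕ []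
    ≈⟨ ∙-congʳ {[]} (∙-congʳ {C₁} (∙-congˡ {M} (prefix-cong (x ∷ []) (shwʸ-z-++ j w)))) ⟩
  M ⊕ prefix (x ∷ []) (Σ ⊕ C ⊕ Q ⊕ R) ⊕ C₁ ⊕ []
    ≡⟨ cong (λ p → M ⊕ p ⊕ C₁ ⊕ []) x-prefix ⟩
  M ⊕ (xΣ ⊕ C₂ ⊕ xQ ⊕ xR) ⊕ C₁ ⊕ []
    ≈⟨ regroup ⟩
  M ⊕ xΣ ⊕ (C₁ ⊕ C₂) ⊕ xQ ⊕ xR
    ≈⟨ ∙-congʳ {xR} (∙-congʳ {xQ} (∙-congˡ {M ⊕ xΣ} (cmono-+ (- 1ℚ) (- ℕ→ℚ (suc j)) 1 (x ∷ x ∷ u)))) ⟩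
  M ⊕ xΣ ⊕ cmono (- 1ℚ +ℚ - ℕ→ℚ (suc j)) 1 (x ∷ x ∷ u) ⊕ xQ ⊕ xR
    ≡⟨ cong₂ (λ s c → s ⊕ cmono c 1 (x ∷ x ∷ u) ⊕ xQ ⊕ xR) (sym (sumZ-suc j w)) (sym (-ℕ→ℚ-suc (suc j))) ⟩
  sumZ (suc (suc j)) w ⊕ cmono (- ℕ→ℚ (suc (suc j))) 1 (x ∷ x ∷ u) ⊕ xQ ⊕ xR
    ≡⟨ cong₂ (λ q r → sumZ (suc (suc j)) w ⊕ cmono (- ℕ→ℚ (suc (suc j))) 1 (x ∷ x ∷ u) ⊕ q ⊕ r)
             (prefix-prefix (x ∷ []) (z (suc j)) (shwʸ w)) (prefix-prefix (x ∷ []) (replicate j x) (δρ w y (y ∷ []))) ⟩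
  sumZ (suc (suc j)) w ⊕ cmono (- ℕ→ℚ (suc (suc j))) 1 (x ∷ x ∷ u)
    ⊕ prefix (z (suc (suc j))) (shwʸ w) ⊕ prefix (replicate (suc j) x) (δρ w y (y ∷ [])) ∎
  where
  u = z (suc j) ++ w
  M = mono (y ∷ x ∷ u)
  C₁ = cmono (- 1ℚ) 1 (x ∷ x ∷ u)
  Σ = sumZ (suc j) w
  C = cmono (- ℕ→ℚ (suc j)) 1 (x ∷ u)
  Q = prefix (z (suc j)) (shwʸ w)
  R = prefix (replicate j x) (δρ w y (y ∷ []))
  xΣ = prefix (x ∷ []) Σ
  C₂ = prefix (x ∷ []) C
  xQ = prefix (x ∷ []) Q
  xR = prefix (x ∷ []) R
  x-prefix : prefix (x ∷ []) (Σ ⊕ C ⊕ Q ⊕ R) ≡ xΣ ⊕ C₂ ⊕ xQ ⊕ xR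
  x-prefix = trans (prefix-⊕ (x ∷ []) (Σ ⊕ C ⊕ Q) R)
    (cong (_⊕ xR) (trans (prefix-⊕ (x ∷ []) (Σ ⊕ C) Q) (cong (_⊕ xQ) (prefix-⊕ (x ∷ []) Σ C))))
  regroup : M ⊕ (xΣ ⊕ C₂ ⊕ xQ ⊕ xR) ⊕ C₁ ⊕ [] ≋ M ⊕ xΣ ⊕ (C₁ ⊕ C₂) ⊕ xQ ⊕ xR
  regroup = ⊕-Solver.prove 6
    (((m ⊞ (((σ ⊞ c₂) ⊞ q) ⊞ r)) ⊞ c₁) ⊞ ⊕-Solver.id)
    ((((m ⊞ σ) ⊞ (c₁ ⊞ c₂)) ⊞ q) ⊞ r)
    (M ∷ xΣ ∷ C₂ ∷ xQ ∷ xR ∷ C₁ ∷ [])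
    where
    open ⊕-Solver using (var) renaming (_⊕_ to _⊞_)
    m = var zero
    σ = var (suc zero)
    c₂ = var (suc (suc zero))
    q = var (suc (suc (suc zero)))
    r = var (suc (suc (suc (suc zero))))
    c₁ = var (suc (suc (suc (suc (suc zero)))))

y⧢zₖ : ∀ j → mono (y ∷ []) ⧢ mono (z (suc j) ++ [])
  ≋ sumZ (suc j) [] ⊕ cmono (- ℕ→ℚ (suc j + 1)) 1 (z (suc j + 1)) ⊕ mono (z (suc j) ++ z 1)
y⧢zₖ j = begin
  mono (y ∷ []) ⧢ mono (z k ++ [])
    ≈⟨ mono-⧢-mono (y ∷ []) (z k ++ []) ⟩
  shwʸ (z k ++ [])
    ≈⟨ shwʸ-z-++ j [] ⟩
  Σ ⊕ cmono (- ℕ→ℚ k) 1 (x ∷ z k ++ []) ⊕ Mz ⊕ cmono (- 1ℚ) 1 (replicate j x ++ z 2)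
    ≡⟨ cong₂ (λ u v → Σ ⊕ cmono (- ℕ→ℚ k) 1 (x ∷ u) ⊕ Mz ⊕ cmono (- 1ℚ) 1 v)
             (++-identityʳ (z k)) (replicate-x-++-z₂ j) ⟩
  Σ ⊕ Cₖ ⊕ Mz ⊕ C₁
    ≈⟨ regroup ⟩
  Σ ⊕ (C₁ ⊕ Cₖ) ⊕ Mz
    ≈⟨ ∙-congʳ {Mz} (∙-congˡ {Σ} (cmono-+ (- 1ℚ) (- ℕ→ℚ k) 1 (x ∷ z k))) ⟩
  Σ ⊕ cmono (- 1ℚ +ℚ - ℕ→ℚ k) 1 (x ∷ z k) ⊕ Mz
    ≡⟨ cong (λ c → Σ ⊕ cmono c 1 (x ∷ z k) ⊕ Mz) (sym (-ℕ→ℚ-suc k)) ⟩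
  Σ ⊕ cmono (- ℕ→ℚ (suc k)) 1 (z (suc k)) ⊕ Mz
    ≡⟨ cong (λ m → Σ ⊕ cmono (- ℕ→ℚ m) 1 (z m) ⊕ Mz) (+-comm 1 k) ⟩
  Σ ⊕ cmono (- ℕ→ℚ (k + 1)) 1 (z (k + 1)) ⊕ Mz ∎
  where
  k = suc j
  Σ = sumZ k []
  Mz = mono (z k ++ z 1)
  Cₖ = cmono (- ℕ→ℚ k) 1 (x ∷ z k)
  C₁ = cmono (- 1ℚ) 1 (x ∷ z k)
  regroup : Σ ⊕ Cₖ ⊕ Mz ⊕ C₁ ≋ Σ ⊕ (C₁ ⊕ Cₖ) ⊕ Mz
  regroup = ⊕-Solver.prove 4 (((σ ⊞ cₖ) ⊞ m) ⊞ c₁) ((σ ⊞ (c₁ ⊞ cₖ)) ⊞ m) (Σ ∷ Cₖ ∷ Mz ∷ C₁ ∷ [])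
    where
    open ⊕-Solver using (var) renaming (_⊕_ to _⊞_)
    σ = var zero
    cₖ = var (suc zero)
    m = var (suc (suc zero))
    c₁ = var (suc (suc (suc zero)))

y⧢zₖw : ∀ j w → w ≢ [] → mono (y ∷ []) ⧢ mono (z (suc j) ++ w)
  ≋ sumZ (suc j) w ⊕ cmono (- ℕ→ℚ (suc j)) 1 (z (suc j + 1) ++ w) ⊕ prefix (z (suc j)) (mono (y ∷ []) ⧢ mono w)
y⧢zₖw j [] w≢[] = ⊥-elim (w≢[] refl)
y⧢zₖw j w@(_ ∷ _) _ = begin
  mono (y ∷ []) ⧢ mono (z k ++ w)
    ≈⟨ mono-⧢-mono (y ∷ []) (z k ++ w) ⟩
  shwʸ (z k ++ w)
    ≈⟨ shwʸ-z-++ j w ⟩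
  Σ ⊕ C ⊕ prefix (z k) (shwʸ w) ⊕ []
    ≈⟨ identityʳ (Σ ⊕ C ⊕ prefix (z k) (shwʸ w)) ⟩
  Σ ⊕ C ⊕ prefix (z k) (shwʸ w)
    ≈⟨ ∙-congˡ {Σ ⊕ C} (prefix-cong (z k) (≋-sym (mono-⧢-mono (y ∷ []) w))) ⟩
  Σ ⊕ C ⊕ prefix (z k) (mono (y ∷ []) ⧢ mono w)
    ≡⟨ cong (λ m → Σ ⊕ cmono (- ℕ→ℚ k) 1 (z m ++ w) ⊕ prefix (z k) (mono (y ∷ []) ⧢ mono w)) (+-comm 1 k) ⟩
  Σ ⊕ cmono (- ℕ→ℚ k) 1 (z (k + 1) ++ w) ⊕ prefix (z k) (mono (y ∷ []) ⧢ mono w) ∎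
  where
  k = suc j
  Σ = sumZ k w
  C = cmono (- ℕ→ℚ k) 1 (x ∷ z k ++ w)

lemma2p11 : (k : ℕ) → 1 ≤ k → (w : Word) →
    (w ≡ [] → mono (y ∷ []) ⧢ mono (z k ++ w)
                ≈ sumZ k [] ⊕ cmono (- ℕ→ℚ (k + 1)) 1 (z (k + 1)) ⊕ mono (z k ++ z 1))
    × (w ≢ [] → mono (y ∷ []) ⧢ mono (z k ++ w)
                ≈ sumZ k w ⊕ cmono (- ℕ→ℚ k) 1 (z (k + 1) ++ w) ⊕ prefix (z k) (mono (y ∷ []) ⧢ mono w))
lemma2p11 (suc j) _ w =
  (λ { refl → get (y⧢zₖ j) }) , (λ w≢[] → get (y⧢zₖw j w w≢[]))
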